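{- Let $G$ be a connected graph, $T,T'$ elimination trees of $G$, $k$ a positive integer, and let $\sigma$ be an $\ell$-rotation sequence from $T$ to $T'$ for some $\ell\le k$. For every vertex $v\in V(T)$, there are at most $k$ children $u$ of $v$ in $T$ such that $\sigma$ uses a vertex of the subtree $T(u)$.
   Context: An elimination tree of a connected graph $G$ is a rooted tree on $V(G)$ obtained by choosing a root $v$ and making the roots of elimination trees of the components of $G-v$ its unordered children; $T(u)$ is the subtree rooted at $u$. For $uv\in E(T)$ with $u$ the parent of $v$, $\mathrm{rot}(T,uv)$ is the elimination tree in which: $v$ becomes the parent of $u$; $v$ replaces $u$ among the children of the parent $z$ of $u$ (or becomes the root if $u$ was the root); children of $u$ remain children of $u$; each child $w$ of $v$ in $T$ becomes a child of $u$ if $u$ is adjacent in $G$ to a vertex of $T(w)$, else stays a child of $v$; all other vertices keep their children. An $\ell$-rotation sequence from $T$ to $T'$ is an ordered list of edges $(e_1,\dots,e_\ell)$ with $T_0=T$, $T_i=\mathrm{rot}(T_{i-1},e_i)$, $e_i\in E(T_{i-1})$, and $T_\ell=T'$. A vertex is used by the sequence if it is an endpoint of some $e_i$. -}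

module Defs where

open import Data.Nat using (ℕ; _≤_; _<_)
open import Data.Fin using (Fin)
open import Data.Fin.Subset using (Subset; _∈_; _-_; ⊤)
open import Data.Bool using (Bool; true; false)
open import Data.Maybe using (Maybe; just; nothing)
open import Data.List using (List; []; _∷_; length)
open import Data.List.Relation.Unary.All using (All)
open import Data.List.Relation.Unary.Unique.Propositional using (Unique)
open import Data.List.Membership.Propositional using () renaming (_∈_ to _∈ₗ_)
open import Data.Sum using (_⊎_)
open import Data.Product using (Σ; ∃; _×_; _,_)
open import Relation.Binary.PropositionalEquality using (_≡_)
open import Relation.Nullary using (¬_)

record Graph (n : ℕ) : Set where
  field
    adj    : Fin n → Fin n → Bool
    sym    : ∀ x y → adj x y ≡ adj y x
    irrefl : ∀ x → adj x x ≡ false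
open Graph public

module _ {n : ℕ} (G : Graph n) where

  data Reach (C : Subset n) : Fin n → Fin n → Set where
    here : ∀ {x} → x ∈ C → Reach C x x
    step : ∀ {x y z} → x ∈ C → adj G x y ≡ true → Reach C y z → Reach C x z

  Connected : Set
  Connected = ∀ x y → Reach ⊤ x y

  IsComponent : Subset n → Subset n → Set
  IsComponent S C =
      (∀ x → x ∈ C → x ∈ S)
    × (∃ λ x → x ∈ C)
    × (∀ x y → x ∈ C → y ∈ C → Reach C x y)
    × (∀ x y → x ∈ C → y ∈ S → adj G x y ≡ true → y ∈ C)

-- A rooted tree on Fin n, given by its parent function (nothing = root).
Tree : ℕ → Set
Tree n = Fin n → Maybe (Fin n)

module _ {n : ℕ} (G : Graph n) (T : Tree n) where

  data ET (S : Subset n) (r : Fin n) : Set where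
    mk : r ∈ S
       → (∀ C → IsComponent G (S - r) C →
            Σ (Fin n) λ c → c ∈ C × T c ≡ just r × ET C c)
       → ET S r

IsElimTree : ∀ {n} → Graph n → Tree n → Set
IsElimTree {n} G T = Σ (Fin n) λ r → T r ≡ nothing × ET G T ⊤ r

-- Desc T w x : x is a vertex of the subtree T(w).
data Desc {n : ℕ} (T : Tree n) (w : Fin n) : Fin n → Set where
  self  : Desc T w w
  below : ∀ {x y} → T x ≡ just y → Desc T w y → Desc T w x

-- Rot G T u v T' : (u,v) is an edge of T with u the parent of v, and T' = rot(T, uv).
record Rot {n : ℕ} (G : Graph n) (T : Tree n) (u v : Fin n) (T' : Tree n) : Set where
  field
    edge     : T v ≡ just u
    at-v     : T' v ≡ T u
    at-u     : T' u ≡ just v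
    child-v-adj   : ∀ w → T w ≡ just v →
                    (∃ λ y → Desc T w y × adj G u y ≡ true) → T' w ≡ just u
    child-v-nadj  : ∀ w → T w ≡ just v →
                    ¬ (∃ λ y → Desc T w y × adj G u y ≡ true) → T' w ≡ just v
    others   : ∀ x → ¬ x ≡ v → ¬ x ≡ u → ¬ T x ≡ just v → T' x ≡ T x

-- RotSeq G T T' σ : σ (a list of edges (parent , child)) is a rotation
-- sequence from T to T'; its length ℓ is length σ.
data RotSeq {n : ℕ} (G : Graph n) : Tree n → Tree n → List (Fin n × Fin n) → Set where
  done : ∀ {T T'} → (∀ x → T x ≡ T' x) → RotSeq G T T' []
  rot  : ∀ {T T₁ T' u v σ} → Rot G T u v T₁ → RotSeq G T₁ T' σ
       → RotSeq G T T' ((u , v) ∷ σ)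

Used : ∀ {n} → List (Fin n × Fin n) → Fin n → Set
Used σ x = ∃ λ y → ((x , y) ∈ₗ σ) ⊎ ((y , x) ∈ₗ σ)

-- Distinct children of v have disjoint subtrees, because every vertex of an elimination
-- tree lies below its root. A rotation at an edge ab, with b the child of a, changes the
-- parents of a, b and the children of b only, so a subtree T(u) not containing b keeps its
-- vertex set, and a used vertex in it is used by the rest of the sequence (as a, b ∉ T(u)).
-- Of pairwise disjoint subtrees at most one contains b, so by induction on the sequence,
-- pairwise disjoint subtrees that each contain a used vertex are at most as many as the
-- rotations.

module Submission where

open import Defs hiding (sym)
open import Data.Nat using (ℕ; _≤_; _<_; _≤?_; suc; z≤n; s≤s)
open import Data.Nat.Properties using (≤-refl; ≤-trans)
open import Data.Fin using (Fin; _≟_) renaming (zero to fzero; suc to fsuc)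
open import Data.Fin.Subset using (Subset; _∈_)
open import Data.Fin.Subset.Properties using (∈⊤; x∈p∧x∉q⇒x∈p─q; x≢y⇒x∉⁅y⁆)
open import Data.Vec using (tabulate)
open import Data.Vec.Properties using (lookup∘tabulate; []=⇒lookup; lookup⇒[]=)
open import Data.Bool using (true)
open import Data.Maybe using (Maybe; just; nothing)
open import Data.Maybe.Properties using (just-injective; ≡-dec)
open import Data.List using (List; _∷_; length; filter)
open import Data.List.Properties using (filter-all)
open import Data.List.Relation.Unary.All as All using (All; []; _∷_)
import Data.List.Relation.Unary.All.Properties as Allₚ
open import Data.List.Relation.Unary.AllPairs as AllPairs using (AllPairs; []; _∷_)
import Data.List.Relation.Unary.AllPairs.Properties as AllPairsₚ
open import Data.List.Relation.Unary.Any using (here; there)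
open import Data.List.Relation.Unary.Unique.Propositional using (Unique)
open import Data.Product using (∃; _×_; _,_; proj₁; proj₂; uncurry)
open import Data.Sum using (_⊎_; inj₁; inj₂; [_,_])
open import Data.Empty using (⊥)
open import Effect.Monad using (RawMonad)
open import Level using (0ℓ)
open import Function using (_∘_; id)
open import Relation.Nullary using (¬_; Dec; yes; no; does; contradiction)
open import Relation.Nullary.Decidable using (decidable-stable; ¬¬-excluded-middle; dec-true)
open import Relation.Nullary.Negation using (¬¬-Monad)
open import Relation.Unary using (Pred; Decidable)
open import Relation.Unary.Properties using (∁?)
open import Relation.Binary.PropositionalEquality using (_≡_; _≢_; refl; sym; trans; subst)

-- Subtree membership, reachability and the adjacency test of a rotation are not decidable
-- here, so the argument runs in the double-negation monad; the conclusion, an inequality of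
-- natural numbers, is stable.
open RawMonad (¬¬-Monad {0ℓ})

private
  variable
    n : ℕ

¬¬-decidable : ∀ {m} (P : Pred (Fin m) 0ℓ) → ¬ ¬ Decidable P
¬¬-decidable {0}     P = return λ ()
¬¬-decidable {suc m} P = do
  P0? ← ¬¬-excluded-middle
  Psuc? ← ¬¬-decidable (P ∘ fsuc)
  return λ { fzero → P0? ; (fsuc i) → Psuc? i }

module _ {m} {P : Pred (Fin m) 0ℓ} (P? : Decidable P) where

  subset : Subset m
  subset = tabulate (does ∘ P?)

  ∈-subset⁺ : ∀ {x} → P x → x ∈ subset
  ∈-subset⁺ {x} px =
    lookup⇒[]= x subset (trans (lookup∘tabulate (does ∘ P?) x) (dec-true (P? x) px))

  ∈-subset⁻ : ∀ {x} → x ∈ subset → P x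
  ∈-subset⁻ {x} x∈ with P? x | trans (sym (lookup∘tabulate (does ∘ P?) x)) ([]=⇒lookup x∈)
  ... | yes px | _  = px
  ... | no  _  | ()

AllPairs-mapWithAll : ∀ {A : Set} {P : Pred A 0ℓ} {R S : A → A → Set}
                    → (∀ {x y} → P x → P y → R x y → S x y)
                    → ∀ {xs} → All P xs → AllPairs R xs → AllPairs S xs
AllPairs-mapWithAll f []         []           = []
AllPairs-mapWithAll f (px ∷ pxs) (rxs ∷ rxss) =
  All.zipWith (λ (py , rxy) → f px py rxy) (pxs , rxs) ∷ AllPairs-mapWithAll f pxs rxss

length≤suc-length-filter : ∀ {A : Set} {P : Pred A 0ℓ} (P? : Decidable P) {xs}
                         → AllPairs (λ x y → P x ⊎ P y) xs → length xs ≤ suc (length (filter P? xs))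
length≤suc-length-filter P? []                 = z≤n
length≤suc-length-filter P? {x ∷ xs} (Px⊎Py ∷ pairs) with P? x
... | yes _  = s≤s (length≤suc-length-filter P? pairs)
... | no ¬Px rewrite filter-all P? (All.map [ (λ Px → contradiction Px ¬Px) , id ] Px⊎Py) =
  ≤-refl

module _ (G : Graph n) {C : Subset n} where

  Reach-target : ∀ {x y} → Reach G C x y → y ∈ C
  Reach-target (here y∈C)     = y∈C
  Reach-target (step _ _ x↝y) = Reach-target x↝y

  Reach-source : ∀ {x y} → Reach G C x y → x ∈ C
  Reach-source (here x∈C)     = x∈C
  Reach-source (step x∈C _ _) = x∈C

  Reach-snoc : ∀ {x y z} → Reach G C x y → adj G y z ≡ true → z ∈ C → Reach G C x z
  Reach-snoc (here y∈C)         y~z z∈C = step y∈C y~z (here z∈C)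
  Reach-snoc (step x∈C x~w w↝y) y~z z∈C = step x∈C x~w (Reach-snoc w↝y y~z z∈C)

  Reach-sym : ∀ {x y} → Reach G C x y → Reach G C y x
  Reach-sym (here x∈C)                 = here x∈C
  Reach-sym (step {x} {w} x∈C x~w w↝y) =
    Reach-snoc (Reach-sym w↝y) (trans (Graph.sym G w x) x~w) x∈C

  Reach-trans : ∀ {x y z} → Reach G C x y → Reach G C y z → Reach G C x z
  Reach-trans (here _)           y↝z = y↝z
  Reach-trans (step x∈C x~w w↝y) y↝z = step x∈C x~w (Reach-trans w↝y y↝z)

Reach-restrict : ∀ (G : Graph n) {S C x y z} → (∀ w → Reach G S x w → w ∈ C)
               → Reach G S x y → Reach G S y z → Reach G C y z
Reach-restrict G closed x↝y (here _)         = here (closed _ x↝y)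
Reach-restrict G closed x↝y (step _ y~w w↝z) =
  step (closed _ x↝y) y~w
       (Reach-restrict G closed (Reach-snoc G x↝y y~w (Reach-source G w↝z)) w↝z)

module _ (G : Graph n) {S : Subset n} {x : Fin n} (reach? : Decidable (Reach G S x)) where

  reachable-component : x ∈ S → IsComponent G S (subset reach?)
  reachable-component x∈S =
      (λ _ → Reach-target G ∘ reached)
    , (x , ∈-subset⁺ reach? (here x∈S))
    , (λ _ _ y∈C z∈C → Reach-restrict G (λ _ → ∈-subset⁺ reach?) (reached y∈C)
                         (Reach-trans G (Reach-sym G (reached y∈C)) (reached z∈C)))
    , (λ _ _ y∈C z∈S y~z → ∈-subset⁺ reach? (Reach-snoc G (reached y∈C) y~z z∈S))
    where
    reached : ∀ {y} → y ∈ subset reach? → Reach G S x y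
    reached = ∈-subset⁻ reach?

¬¬-component : ∀ (G : Graph n) {S x} → x ∈ S → ¬ ¬ (∃ λ C → IsComponent G S C × x ∈ C)
¬¬-component G {S} {x} x∈S = do
  reach? ← ¬¬-decidable (Reach G S x)
  return (subset reach? , reachable-component G reach? x∈S , ∈-subset⁺ reach? (here x∈S))

module _ {T : Tree n} where

  Desc-trans : ∀ {a b c} → Desc T a b → Desc T b c → Desc T a c
  Desc-trans a↝b self             = a↝b
  Desc-trans a↝b (below c→y b↝y) = below c→y (Desc-trans a↝b b↝y)

  Desc-comparable : ∀ {u u' x} → Desc T u x → Desc T u' x → Desc T u u' ⊎ Desc T u' u
  Desc-comparable self            u'↝x               = inj₂ u'↝x
  Desc-comparable (below x→y u↝y) self               = inj₁ (below x→y u↝y)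
  Desc-comparable (below x→y u↝y) (below x→y' u'↝y') with trans (sym x→y) x→y'
  ... | refl = Desc-comparable u↝y u'↝y'

  parent-not-below : ∀ {r u p} → T r ≡ nothing → Desc T r u → T u ≡ just p → ¬ Desc T u p
  parent-not-below r-root self u→p _ with trans (sym r-root) u→p
  ... | ()
  parent-not-below r-root (below u→y r↝y) u→p u↝p with just-injective (trans (sym u→y) u→p)
  parent-not-below r-root (below u→y r↝y) u→p self           | refl =
    parent-not-below r-root r↝y u→y self
  parent-not-below r-root (below u→y r↝y) u→p (below p→q u↝q) | refl =
    parent-not-below r-root r↝y p→q (Desc-trans (below u→y self) u↝q)

ET-spans : ∀ {G : Graph n} {T S r} → ET G T S r → ∀ x → x ∈ S → ¬ ¬ Desc T r x
ET-spans {G = G} {r = r} (mk _ child) x x∈S with x ≟ r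
... | yes refl = return self
... | no  x≢r  = do
  (C , C-comp , x∈C) ← ¬¬-component G (x∈p∧x∉q⇒x∈p─q x∈S (x≢y⇒x∉⁅y⁆ x≢r))
  let (c , _ , c→r , etC) = child C C-comp
  c↝x ← ET-spans etC x x∈C
  return (Desc-trans (below c→r self) c↝x)

Disjoint : Tree n → Fin n → Fin n → Set
Disjoint T w w' = ∀ x → Desc T w x → ¬ Desc T w' x

Touched : Tree n → List (Fin n × Fin n) → Fin n → Set
Touched T σ w = ∃ λ x → Desc T w x × Used σ x

module _ {T : Tree n} {r} (r-root : T r ≡ nothing) (spans : ∀ x → ¬ ¬ Desc T r x) {v : Fin n} where

  sibling-not-below : ∀ {u u'} → T u ≡ just v → T u' ≡ just v → u ≢ u' → ¬ Desc T u u'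
  sibling-not-below u→v u'→v u≢u' self = u≢u' refl
  sibling-not-below {u} u→v u'→v u≢u' (below u'→y u↝y) with just-injective (trans (sym u'→y) u'→v)
  ... | refl = spans u (λ r↝u → parent-not-below r-root r↝u u→v u↝y)

  siblings-disjoint : ∀ {u u'} → T u ≡ just v → T u' ≡ just v → u ≢ u' → Disjoint T u u'
  siblings-disjoint u→v u'→v u≢u' x u↝x u'↝x with Desc-comparable u↝x u'↝x
  ... | inj₁ u↝u' = sibling-not-below u→v u'→v u≢u' u↝u'
  ... | inj₂ u'↝u = sibling-not-below u'→v u→v (u≢u' ∘ sym) u'↝u

  children-disjoint : ∀ {cs} → Unique cs → All (λ u → T u ≡ just v) cs → AllPairs (Disjoint T) cs
  children-disjoint unique children = AllPairs-mapWithAll siblings-disjoint children unique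

module Rotation {G : Graph n} {T T₁ : Tree n} {a b : Fin n} (R : Rot G T a b T₁) where
  open Rot R

  avoids-parent : ∀ {w} → ¬ Desc T w b → ¬ Desc T w a
  avoids-parent b∉ w↝a = b∉ (below edge w↝a)

  child-of-b-reparented : ∀ {x} → T x ≡ just b → ¬ ¬ (T₁ x ≡ just a ⊎ T₁ x ≡ just b)
  child-of-b-reparented {x} x→b = reparent <$> ¬¬-excluded-middle
    where
    reparent : Dec (∃ λ y → Desc T x y × adj G a y ≡ true) → T₁ x ≡ just a ⊎ T₁ x ≡ just b
    reparent (yes a~T[x]) = inj₁ (child-v-adj x x→b a~T[x])
    reparent (no  a≁T[x]) = inj₂ (child-v-nadj x x→b a≁T[x])

  private
    parent-outside : ∀ {w y z} {t : Maybe (Fin n)}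
                   → Desc T w y → ¬ Desc T w z → t ≡ just y → t ≡ just z → ⊥
    parent-outside w↝y z∉ t≡y t≡z =
      z∉ (subst (Desc T _) (just-injective (trans (sym t≡y) t≡z)) w↝y)

  parent-preserved : ∀ {w x y} → ¬ Desc T w b → Desc T w y → T x ≡ just y → T₁ x ≡ just y
  parent-preserved {w} {x} b∉ w↝y x→y = trans (others x x≢b x≢a x↛b) x→y
    where
    x≢b : x ≢ b
    x≢b refl = b∉ (below x→y w↝y)
    x≢a : x ≢ a
    x≢a refl = avoids-parent b∉ (below x→y w↝y)
    x↛b : T x ≢ just b
    x↛b = parent-outside w↝y b∉ x→y

  parent-reflected : ∀ {w x y} → ¬ Desc T w b → Desc T w y → T₁ x ≡ just y → ¬ ¬ (T x ≡ just y)
  parent-reflected {x = x} b∉ w↝y x→₁y with x ≟ b | x ≟ a | ≡-dec _≟_ (T x) (just b)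
  ... | yes refl | _        | _       =
        contradiction (below (trans (sym at-v) x→₁y) w↝y) (avoids-parent b∉)
  ... | no _     | yes refl | _       = contradiction at-u (parent-outside w↝y b∉ x→₁y)
  ... | no _     | no _     | yes x→b = λ _ → child-of-b-reparented x→b
        [ parent-outside w↝y (avoids-parent b∉) x→₁y , parent-outside w↝y b∉ x→₁y ]
  ... | no x≢b   | no x≢a   | no x↛b  = return (trans (sym (others x x≢b x≢a x↛b)) x→₁y)

  Desc-preserved : ∀ {w x} → ¬ Desc T w b → Desc T w x → Desc T₁ w x
  Desc-preserved b∉ self            = self
  Desc-preserved b∉ (below x→y w↝y) =
    below (parent-preserved b∉ w↝y x→y) (Desc-preserved b∉ w↝y)

  Desc-reflected : ∀ {w x} → ¬ Desc T w b → Desc T₁ w x → ¬ ¬ Desc T w x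
  Desc-reflected b∉ self              = return self
  Desc-reflected b∉ (below x→₁y w↝₁y) = do
    w↝y ← Desc-reflected b∉ w↝₁y
    x→y ← parent-reflected b∉ w↝y x→₁y
    return (below x→y w↝y)

  Disjoint-preserved : ∀ {w w'} → ¬ Desc T w b → ¬ Desc T w' b
                     → Disjoint T w w' → Disjoint T₁ w w'
  Disjoint-preserved b∉w b∉w' disjoint x w↝₁x w'↝₁x =
    Desc-reflected b∉w w↝₁x λ w↝x → Desc-reflected b∉w' w'↝₁x λ w'↝x → disjoint x w↝x w'↝x

  Touched-preserved : ∀ {σ w} → ¬ Desc T w b → Touched T ((a , b) ∷ σ) w → Touched T₁ σ w
  Touched-preserved b∉ (x , w↝x , _ , inj₁ (here refl)) = contradiction w↝x (avoids-parent b∉)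
  Touched-preserved b∉ (x , w↝x , _ , inj₂ (here refl)) = contradiction w↝x b∉
  Touched-preserved b∉ (x , w↝x , y , inj₁ (there xy∈σ)) =
    x , Desc-preserved b∉ w↝x , y , inj₁ xy∈σ
  Touched-preserved b∉ (x , w↝x , y , inj₂ (there yx∈σ)) =
    x , Desc-preserved b∉ w↝x , y , inj₂ yx∈σ

Disjoint⇒length≤suc-avoiding : ∀ {T : Tree n} {b} (desc? : Decidable (λ w → Desc T w b)) {W}
                             → AllPairs (Disjoint T) W → length W ≤ suc (length (filter (∁? desc?) W))
Disjoint⇒length≤suc-avoiding {T = T} {b} desc? =
  length≤suc-length-filter (∁? desc?) ∘ AllPairs.map avoids-one
  where
  avoids-one : ∀ {w w'} → Disjoint T w w' → ¬ Desc T w b ⊎ ¬ Desc T w' b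
  avoids-one {w} disjoint with desc? w
  ... | yes w↝b = inj₂ (disjoint b w↝b)
  ... | no  b∉w = inj₁ b∉w

touched≤rotations : ∀ {G : Graph n} {T T' σ W} → RotSeq G T T' σ
                  → AllPairs (Disjoint T) W → All (Touched T σ) W → ¬ ¬ (length W ≤ length σ)
touched≤rotations (done _) [] []                          = return z≤n
touched≤rotations (done _) _  ((_ , _ , _ , inj₁ ()) ∷ _)
touched≤rotations (done _) _  ((_ , _ , _ , inj₂ ()) ∷ _)
touched≤rotations {T = T} {W = W} (rot {v = b} R rest) disjoint touched = do
  desc? ← ¬¬-decidable (λ w → Desc T w b)
  let avoiding? = ∁? desc?
      b∉ = Allₚ.all-filter avoiding? W
  bound ← touched≤rotations rest
            (AllPairs-mapWithAll Disjoint-preserved b∉ (AllPairsₚ.filter⁺ avoiding? disjoint))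
            (All.zipWith (uncurry Touched-preserved) (b∉ , Allₚ.filter⁺ avoiding? touched))
  return (≤-trans (Disjoint⇒length≤suc-avoiding desc? disjoint) (s≤s bound))
  where open Rotation R

lemma13 : ∀ {n} (G : Graph n) → Connected G
    → (T T' : Tree n) → IsElimTree G T → IsElimTree G T'
    → (k : ℕ) → 0 < k
    → (σ : List (Fin n × Fin n)) → RotSeq G T T' σ → length σ ≤ k
    → (v : Fin n) (cs : List (Fin n)) → Unique cs
    → All (λ u → T u ≡ just v × ∃ λ x → Desc T u x × Used σ x) cs
    → length cs ≤ k
lemma13 G _ T _ (r , r-root , T-is-ET) _ k _ σ rotations σ≤k v cs unique children =
  ≤-trans (decidable-stable (length cs ≤? length σ) cs≤σ) σ≤k
  where
  disjoint : AllPairs (Disjoint T) cs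
  disjoint = children-disjoint r-root (λ x → ET-spans T-is-ET x ∈⊤) unique
                                (All.map proj₁ children)

  cs≤σ : ¬ ¬ (length cs ≤ length σ)
  cs≤σ = touched≤rotations rotations disjoint (All.map proj₂ children)
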